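{- Let $\mathbf{P}\colon\mathsf{C}^{\mathrm{op}}\to\mathsf{BA}$ be a Boolean doctrine, $\mathbf{R}\colon\mathsf{D}^{\mathrm{op}}\to\mathsf{BA}$ a first-order Boolean doctrine, and $(M,\mathfrak{m})\colon\mathbf{P}\to\mathbf{R}$ a Boolean doctrine morphism. Let $\bar i,\bar j\in\mathbb{N}$, $S,Y_1,\dots,Y_{\bar i},Z_1,\dots,Z_{\bar j}\in\mathsf{C}$, $\alpha_i\in\mathbf{P}(S\times Y_i)$, $\beta_j\in\mathbf{P}(S\times Z_j)$. Suppose there are $n\in\mathbb{N}$, $l_1,\dots,l_n\in\{1,\dots,\bar i\}$ and morphisms $g_i\colon S\times\prod_{j=1}^{\bar j}Z_j\to Y_{l_i}$ such that in $\mathbf{P}(S\times\prod_jZ_j)$, $\bigwedge_{i=1}^n\mathbf{P}(\langle\mathrm{pr}_1,g_i\rangle)(\alpha_{l_i})\le\bigvee_{j=1}^{\bar j}\mathbf{P}(\langle\mathrm{pr}_1,\mathrm{pr}_{j+1}\rangle)(\beta_j)$. Then in $\mathbf{R}(M(S))$, \[\bigwedge_{i=1}^{\bar i}\forall^{M(Y_i)}_{M(S)}\mathfrak{m}_{S\times Y_i}(\alpha_i)\le\bigvee_{j=1}^{\bar j}\forall^{M(Z_j)}_{M(S)}\mathfrak{m}_{S\times Z_j}(\beta_j).\]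
   Context: Categories have finite products; $\mathrm{pr}_k$ projections, $\langle f,g\rangle$ induced morphisms into products. A Boolean doctrine is a functor $\mathbf{P}\colon\mathsf{C}^{\mathrm{op}}\to\mathsf{BA}$. A Boolean doctrine morphism $(M,\mathfrak{m})\colon\mathbf{P}\to\mathbf{R}$ consists of a finite-product-preserving functor $M\colon\mathsf{C}\to\mathsf{D}$ and a natural transformation $\mathfrak{m}\colon\mathbf{P}\Rightarrow\mathbf{R}\circ M^{\mathrm{op}}$ (so $M(S\times Y)$ is identified with $M(S)\times M(Y)$). A first-order Boolean doctrine is a Boolean doctrine in which each $\mathbf{R}(\mathrm{pr}_1)\colon\mathbf{R}(X)\to\mathbf{R}(X\times Y)$ has a right adjoint $\forall^Y_X$ satisfying the Beck–Chevalley condition $\mathbf{R}(f)\circ\forall^Y_X=\forall^Y_{X'}\circ\mathbf{R}(f\times\mathrm{id}_Y)$ for $f\colon X'\to X$. -}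

module Defs where

open import Level using (Level; _⊔_) renaming (suc to lsuc)
open import Data.Nat using (ℕ; zero; suc)
open import Data.Fin using (Fin; zero; suc)
open import Function using (_∘′_)
open import Relation.Binary using (Rel; IsEquivalence)
open import Algebra.Lattice.Bundles using (BooleanAlgebra)

record Category (o h e : Level) : Set (lsuc (o ⊔ h ⊔ e)) where
  infixr 9 _∘_
  infix  4 _≈_
  field
    Obj       : Set o
    Hom       : Obj → Obj → Set h
    _≈_       : ∀ {A B} → Rel (Hom A B) e
    ≈-equiv   : ∀ {A B} → IsEquivalence (_≈_ {A} {B})
    id        : ∀ {A} → Hom A A
    _∘_       : ∀ {A B C} → Hom B C → Hom A B → Hom A C
    identityˡ : ∀ {A B} {f : Hom A B} → id ∘ f ≈ f
    identityʳ : ∀ {A B} {f : Hom A B} → f ∘ id ≈ f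
    assoc     : ∀ {A B C D} {f : Hom A B} {g : Hom B C} {h : Hom C D} →
                (h ∘ g) ∘ f ≈ h ∘ (g ∘ f)
    ∘-resp-≈  : ∀ {A B C} {f f′ : Hom B C} {g g′ : Hom A B} →
                f ≈ f′ → g ≈ g′ → f ∘ g ≈ f′ ∘ g′

record FiniteProducts {o h e} (C : Category o h e) : Set (o ⊔ h ⊔ e) where
  open Category C
  infixr 7 _×_
  field
    ⊤       : Obj
    !       : ∀ {A} → Hom A ⊤
    !-unique : ∀ {A} (f : Hom A ⊤) → f ≈ !
    _×_     : Obj → Obj → Obj
    pr₁     : ∀ {A B} → Hom (A × B) A
    pr₂     : ∀ {A B} → Hom (A × B) B
    ⟨_,_⟩   : ∀ {X A B} → Hom X A → Hom X B → Hom X (A × B)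
    pr₁-⟨⟩  : ∀ {X A B} {f : Hom X A} {g : Hom X B} → pr₁ ∘ ⟨ f , g ⟩ ≈ f
    pr₂-⟨⟩  : ∀ {X A B} {f : Hom X A} {g : Hom X B} → pr₂ ∘ ⟨ f , g ⟩ ≈ g
    ⟨⟩-unique : ∀ {X A B} {f : Hom X A} {g : Hom X B} {k : Hom X (A × B)} →
                pr₁ ∘ k ≈ f → pr₂ ∘ k ≈ g → k ≈ ⟨ f , g ⟩

  _⊗id : ∀ {X′ X Y} → Hom X′ X → Hom (X′ × Y) (X × Y)
  f ⊗id = ⟨ f ∘ pr₁ , pr₂ ⟩

  ∏ : (n : ℕ) → (Fin n → Obj) → Obj
  ∏ zero    Z = ⊤
  ∏ (suc n) Z = Z zero × ∏ n (Z ∘′ suc)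

  π : (n : ℕ) (Z : Fin n → Obj) (j : Fin n) → Hom (∏ n Z) (Z j)
  π (suc n) Z zero    = pr₁
  π (suc n) Z (suc j) = π n (Z ∘′ suc) j ∘ pr₂

module _ {c ℓ} (B : BooleanAlgebra c ℓ) where
  open BooleanAlgebra B

  Leq : Carrier → Carrier → Set ℓ
  Leq x y = (x ∧ y) ≈ x

  ⋀ : (n : ℕ) → (Fin n → Carrier) → Carrier
  ⋀ zero    a = ⊤
  ⋀ (suc n) a = a zero ∧ ⋀ n (a ∘′ suc)

  ⋁ : (n : ℕ) → (Fin n → Carrier) → Carrier
  ⋁ zero    a = ⊥
  ⋁ (suc n) a = a zero ∨ ⋁ n (a ∘′ suc)

record IsBAHom {c ℓ c′ ℓ′} (A : BooleanAlgebra c ℓ) (B : BooleanAlgebra c′ ℓ′)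
               (f : BooleanAlgebra.Carrier A → BooleanAlgebra.Carrier B)
               : Set (c ⊔ ℓ ⊔ ℓ′) where
  private
    module A = BooleanAlgebra A
    module B = BooleanAlgebra B
  field
    resp-≈ : ∀ {x y} → x A.≈ y → f x B.≈ f y
    pres-∧ : ∀ x y → f (x A.∧ y) B.≈ (f x B.∧ f y)
    pres-∨ : ∀ x y → f (x A.∨ y) B.≈ (f x B.∨ f y)
    pres-¬ : ∀ x → f (A.¬ x) B.≈ (B.¬ f x)
    pres-⊤ : f A.⊤ B.≈ B.⊤
    pres-⊥ : f A.⊥ B.≈ B.⊥

record BooleanDoctrine {o h e} (C : Category o h e) (c ℓ : Level)
       : Set (o ⊔ h ⊔ e ⊔ lsuc (c ⊔ ℓ)) where
  open Category C
  field
    P₀    : Obj → BooleanAlgebra c ℓ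
  Fib : Obj → Set c
  Fib X = BooleanAlgebra.Carrier (P₀ X)
  field
    P₁      : ∀ {X Y} → Hom X Y → Fib Y → Fib X
    P₁-hom  : ∀ {X Y} (f : Hom X Y) → IsBAHom (P₀ Y) (P₀ X) (P₁ f)
    P₁-resp : ∀ {X Y} {f g : Hom X Y} → f ≈ g →
              ∀ a → BooleanAlgebra._≈_ (P₀ X) (P₁ f a) (P₁ g a)
    P₁-id   : ∀ {X} a → BooleanAlgebra._≈_ (P₀ X) (P₁ id a) a
    P₁-∘    : ∀ {X Y Z} (f : Hom X Y) (g : Hom Y Z) a →
              BooleanAlgebra._≈_ (P₀ X) (P₁ (g ∘ f) a) (P₁ f (P₁ g a))

record IsFirstOrder {o h e} {D : Category o h e} (FP : FiniteProducts D)
                    {c ℓ} (R : BooleanDoctrine D c ℓ) : Set (o ⊔ h ⊔ c ⊔ ℓ) where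
  open Category D
  open FiniteProducts FP
  open BooleanDoctrine R
  field
    ∀′      : ∀ (X Y : Obj) → Fib (X × Y) → Fib X
    adj→    : ∀ {X Y} (a : Fib X) (b : Fib (X × Y)) →
              Leq (P₀ (X × Y)) (P₁ pr₁ a) b → Leq (P₀ X) a (∀′ X Y b)
    adj←    : ∀ {X Y} (a : Fib X) (b : Fib (X × Y)) →
              Leq (P₀ X) a (∀′ X Y b) → Leq (P₀ (X × Y)) (P₁ pr₁ a) b
    beck-chevalley : ∀ {X′ X Y} (f : Hom X′ X) (b : Fib (X × Y)) →
              BooleanAlgebra._≈_ (P₀ X′) (P₁ f (∀′ X Y b)) (∀′ X′ Y (P₁ (f ⊗id) b))

record Functor {o h e o′ h′ e′} (C : Category o h e) (D : Category o′ h′ e′)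
       : Set (o ⊔ h ⊔ e ⊔ o′ ⊔ h′ ⊔ e′) where
  private
    module C = Category C
    module D = Category D
  field
    F₀     : C.Obj → D.Obj
    F₁     : ∀ {A B} → C.Hom A B → D.Hom (F₀ A) (F₀ B)
    F-resp : ∀ {A B} {f g : C.Hom A B} → f C.≈ g → F₁ f D.≈ F₁ g
    F-id   : ∀ {A} → F₁ (C.id {A}) D.≈ D.id
    F-∘    : ∀ {A B C′} (f : C.Hom A B) (g : C.Hom B C′) →
             F₁ (g C.∘ f) D.≈ (F₁ g D.∘ F₁ f)

record PreservesFiniteProducts {o h e o′ h′ e′} {C : Category o h e} {D : Category o′ h′ e′}
       (FC : FiniteProducts C) (FD : FiniteProducts D) (M : Functor C D)
       : Set (o ⊔ h ⊔ e ⊔ o′ ⊔ h′ ⊔ e′) where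
  private
    module C = Category C
    module D = Category D
    module FC = FiniteProducts FC
    module FD = FiniteProducts FD
  open Functor M
  field
    u       : D.Hom FD.⊤ (F₀ FC.⊤)
    u-iso   : (u D.∘ FD.! {F₀ FC.⊤}) D.≈ D.id
    φ⁻¹     : ∀ {X Y} → D.Hom (F₀ X FD.× F₀ Y) (F₀ (X FC.× Y))
    φ⁻¹-isoˡ : ∀ {X Y} → (FD.⟨ F₁ (FC.pr₁ {X} {Y}) , F₁ FC.pr₂ ⟩ D.∘ φ⁻¹) D.≈ D.id
    φ⁻¹-isoʳ : ∀ {X Y} → (φ⁻¹ D.∘ FD.⟨ F₁ (FC.pr₁ {X} {Y}) , F₁ FC.pr₂ ⟩) D.≈ D.id

record DoctrineMorphism {o h e o′ h′ e′ c ℓ c′ ℓ′}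
       {C : Category o h e} {D : Category o′ h′ e′}
       (FC : FiniteProducts C) (FD : FiniteProducts D)
       (P : BooleanDoctrine C c ℓ) (R : BooleanDoctrine D c′ ℓ′)
       : Set (o ⊔ h ⊔ e ⊔ o′ ⊔ h′ ⊔ e′ ⊔ c ⊔ ℓ ⊔ c′ ⊔ ℓ′) where
  private
    module C = Category C
    module P = BooleanDoctrine P
    module R = BooleanDoctrine R
  field
    M        : Functor C D
    M-pres   : PreservesFiniteProducts FC FD M
  open Functor M
  field
    𝔪        : ∀ X → P.Fib X → R.Fib (F₀ X)
    𝔪-hom    : ∀ X → IsBAHom (P.P₀ X) (R.P₀ (F₀ X)) (𝔪 X)
    𝔪-natural : ∀ {X Y} (f : C.Hom X Y) (a : P.Fib Y) →
               BooleanAlgebra._≈_ (R.P₀ (F₀ X)) (𝔪 X (P.P₁ f a)) (R.P₁ (F₁ f) (𝔪 Y a))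

{-# OPTIONS --safe #-}
-- Applying 𝔪 moves the hypothesis into R over M(S × ∏ Z).  Pulled back along
-- M pr₁, each ∀ αᵢ lies below all its instances along the M gₖ, so
-- pr₁*(⋀ᵢ ∀ αᵢ) ≤ ⋁ⱼ ⟨pr₁, qⱼ⟩* βⱼ.  The quantifiers are then discharged one
-- disjunct at a time: in a Boolean algebra a ≤ ∀b ∨ c iff a ∧ ¬c ≤ ∀b iff
-- pr₁*a ∧ ¬pr₁*c ≤ b iff pr₁*a ∧ ¬b ≤ pr₁*c, and by Beck–Chevalley pr₁*c is again
-- a disjunction of universal statements, now over X × W₀ and with one disjunct
-- fewer.
module Submission where

open import Defs
open import Level using (Level; _⊔_)
open import Data.Nat using (ℕ; zero; suc)
open import Data.Fin using (Fin; zero; suc)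
open import Function using (_∘′_)
open import Algebra.Lattice.Bundles using (BooleanAlgebra)
import Algebra.Lattice.Properties.Lattice as LatticeProperties
import Algebra.Lattice.Properties.BooleanAlgebra as BooleanAlgebraProperties
open import Relation.Binary.Bundles using (Poset; Setoid)
open import Relation.Binary.Structures using (IsEquivalence)
import Relation.Binary.Reasoning.Setoid as SetoidReasoning
import Relation.Binary.Lattice as OrderLattice
import Relation.Binary.Reasoning.PartialOrder as ≤-Reasoning

module BooleanAlgebraOrder {c ℓ} (B : BooleanAlgebra c ℓ) where
  open BooleanAlgebra B
  open BooleanAlgebraProperties B using (∧-identityʳ; ∨-identityˡ)
  open OrderLattice.Lattice (LatticeProperties.∨-∧-orderTheoreticLattice lattice) public
    using (_≤_; poset; x∧y≤x; x∧y≤y; ∧-greatest; x≤x∨y; y≤x∨y; ∨-least)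
  open Poset poset public
    using (≤-respʳ-≈) renaming (refl to ≤-refl; trans to ≤-trans)
  open ≤-Reasoning poset

  Leq⇒≤ : ∀ {x y} → Leq B x y → x ≤ y
  Leq⇒≤ = sym

  ≤⇒Leq : ∀ {x y} → x ≤ y → Leq B x y
  ≤⇒Leq = sym

  ∧¬≤⇒≤∨ : ∀ {x y z} → x ∧ ¬ y ≤ z → x ≤ y ∨ z
  ∧¬≤⇒≤∨ {x} {y} {z} x∧¬y≤z = begin
    x                    ≈⟨ sym (∧-identityʳ x) ⟩
    x ∧ ⊤                ≈⟨ ∧-congˡ (sym (∨-complementʳ y)) ⟩
    x ∧ (y ∨ ¬ y)        ≈⟨ ∧-distribˡ-∨ x y (¬ y) ⟩
    (x ∧ y) ∨ (x ∧ ¬ y)  ≤⟨ ∨-least (≤-trans (x∧y≤y x y) (x≤x∨y y z)) (≤-trans x∧¬y≤z (y≤x∨y y z)) ⟩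
    y ∨ z                ∎

  ≤∨⇒∧¬≤ : ∀ {x y z} → x ≤ y ∨ z → x ∧ ¬ y ≤ z
  ≤∨⇒∧¬≤ {x} {y} {z} x≤y∨z = begin
    x ∧ ¬ y                  ≤⟨ ∧-greatest (≤-trans (x∧y≤x x (¬ y)) x≤y∨z) (x∧y≤y x (¬ y)) ⟩
    (y ∨ z) ∧ ¬ y            ≈⟨ ∧-distribʳ-∨ (¬ y) y z ⟩
    (y ∧ ¬ y) ∨ (z ∧ ¬ y)    ≈⟨ ∨-congʳ (∧-complementʳ y) ⟩
    ⊥ ∨ (z ∧ ¬ y)            ≈⟨ ∨-identityˡ (z ∧ ¬ y) ⟩
    z ∧ ¬ y                  ≤⟨ x∧y≤x z (¬ y) ⟩
    z                        ∎

  ∧¬≤-contrapose : ∀ {x y z} → x ∧ ¬ y ≤ z → x ∧ ¬ z ≤ y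
  ∧¬≤-contrapose {y = y} {z} x∧¬y≤z =
    ≤∨⇒∧¬≤ (≤-respʳ-≈ (∨-comm y z) (∧¬≤⇒≤∨ x∧¬y≤z))

  ⋀-lower : ∀ n (a : Fin n → Carrier) i → ⋀ B n a ≤ a i
  ⋀-lower (suc n) a zero    = x∧y≤x _ _
  ⋀-lower (suc n) a (suc i) = ≤-trans (x∧y≤y _ _) (⋀-lower n (a ∘′ suc) i)

  ⋀-greatest : ∀ n (a : Fin n → Carrier) {x} → (∀ i → x ≤ a i) → x ≤ ⋀ B n a
  ⋀-greatest zero    a x≤a = sym (∧-identityʳ _)
  ⋀-greatest (suc n) a x≤a = ∧-greatest (x≤a zero) (⋀-greatest n (a ∘′ suc) (λ i → x≤a (suc i)))

  ⋀-cong : ∀ n {a b : Fin n → Carrier} → (∀ i → a i ≈ b i) → ⋀ B n a ≈ ⋀ B n b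
  ⋀-cong zero    a≈b = refl
  ⋀-cong (suc n) a≈b = ∧-cong (a≈b zero) (⋀-cong n (λ i → a≈b (suc i)))

  ⋁-cong : ∀ n {a b : Fin n → Carrier} → (∀ i → a i ≈ b i) → ⋁ B n a ≈ ⋁ B n b
  ⋁-cong zero    a≈b = refl
  ⋁-cong (suc n) a≈b = ∨-cong (a≈b zero) (⋁-cong n (λ i → a≈b (suc i)))

module BooleanAlgebraHomomorphism
  {c ℓ c′ ℓ′} {A : BooleanAlgebra c ℓ} {B : BooleanAlgebra c′ ℓ′}
  {f : BooleanAlgebra.Carrier A → BooleanAlgebra.Carrier B} (f-hom : IsBAHom A B f) where
  private
    module A = BooleanAlgebra A
    module B = BooleanAlgebra B
    module A≤ = BooleanAlgebraOrder A
    module B≤ = BooleanAlgebraOrder B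
  open IsBAHom f-hom

  pres-≤ : ∀ {x y} → x A≤.≤ y → f x B≤.≤ f y
  pres-≤ {x} {y} x≤y = B.trans (resp-≈ x≤y) (pres-∧ x y)

  pres-∧¬ : ∀ x y → f (x A.∧ A.¬ y) B.≈ f x B.∧ B.¬ f y
  pres-∧¬ x y = B.trans (pres-∧ x (A.¬ y)) (B.∧-congˡ (pres-¬ y))

  pres-⋀ : ∀ n (a : Fin n → A.Carrier) → f (⋀ A n a) B.≈ ⋀ B n (λ i → f (a i))
  pres-⋀ zero    a = pres-⊤
  pres-⋀ (suc n) a = B.trans (pres-∧ _ _) (B.∧-congˡ (pres-⋀ n (a ∘′ suc)))

  pres-⋁ : ∀ n (a : Fin n → A.Carrier) → f (⋁ A n a) B.≈ ⋁ B n (λ i → f (a i))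
  pres-⋁ zero    a = pres-⊥
  pres-⋁ (suc n) a = B.trans (pres-∨ _ _) (B.∨-congˡ (pres-⋁ n (a ∘′ suc)))

module CategoryProperties {o h e} (C : Category o h e) where
  open Category C

  module ≈ {A B} = IsEquivalence (≈-equiv {A} {B})

  hom-setoid : Obj → Obj → Setoid h e
  hom-setoid A B = record { isEquivalence = ≈-equiv {A} {B} }

  module HomReasoning {A B} = SetoidReasoning (hom-setoid A B)

-- M (S × ∏ Z) is only isomorphic to M S × ∏ⱼ M Zⱼ, and the induction regroups
-- the factors; all it needs is that cones over the factors factor through the apex.
record IsWeakProduct {o h e} (C : Category o h e) {m} {X E : Category.Obj C}
    (W : Fin m → Category.Obj C) (p : Category.Hom C E X) (q : ∀ j → Category.Hom C E (W j))
    : Set (o ⊔ h ⊔ e) where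
  open Category C
  field
    factor   : ∀ {V} → Hom V X → (∀ j → Hom V (W j)) → Hom V E
    p∘factor : ∀ {V} {f : Hom V X} {g : ∀ j → Hom V (W j)} → p ∘ factor f g ≈ f
    q∘factor : ∀ {V} {f : Hom V X} {g : ∀ j → Hom V (W j)} j → q j ∘ factor f g ≈ g j

module ProductProperties {o h e} {C : Category o h e} (FC : FiniteProducts C) where
  open Category C
  open FiniteProducts FC
  open CategoryProperties C

  ⟨⟩-cong : ∀ {V A B} {f f′ : Hom V A} {g g′ : Hom V B} → f ≈ f′ → g ≈ g′ → ⟨ f , g ⟩ ≈ ⟨ f′ , g′ ⟩
  ⟨⟩-cong f≈f′ g≈g′ = ⟨⟩-unique (≈.trans pr₁-⟨⟩ f≈f′) (≈.trans pr₂-⟨⟩ g≈g′)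

  ⟨⟩-injectiveˡ : ∀ {V A B} {f f′ : Hom V A} {g g′ : Hom V B} → ⟨ f , g ⟩ ≈ ⟨ f′ , g′ ⟩ → f ≈ f′
  ⟨⟩-injectiveˡ eq = ≈.trans (≈.sym pr₁-⟨⟩) (≈.trans (∘-resp-≈ ≈.refl eq) pr₁-⟨⟩)

  ⟨⟩-injectiveʳ : ∀ {V A B} {f f′ : Hom V A} {g g′ : Hom V B} → ⟨ f , g ⟩ ≈ ⟨ f′ , g′ ⟩ → g ≈ g′
  ⟨⟩-injectiveʳ eq = ≈.trans (≈.sym pr₂-⟨⟩) (≈.trans (∘-resp-≈ ≈.refl eq) pr₂-⟨⟩)

  ⟨⟩-η : ∀ {V A B} {k : Hom V (A × B)} → ⟨ pr₁ ∘ k , pr₂ ∘ k ⟩ ≈ k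
  ⟨⟩-η = ≈.sym (⟨⟩-unique ≈.refl ≈.refl)

  ⟨⟩∘ : ∀ {U V A B} {f : Hom V A} {g : Hom V B} {k : Hom U V} → ⟨ f , g ⟩ ∘ k ≈ ⟨ f ∘ k , g ∘ k ⟩
  ⟨⟩∘ = ⟨⟩-unique (≈.trans (≈.sym assoc) (∘-resp-≈ pr₁-⟨⟩ ≈.refl))
                  (≈.trans (≈.sym assoc) (∘-resp-≈ pr₂-⟨⟩ ≈.refl))

  ⊗id∘⟨⟩ : ∀ {V X′ X Y} {f : Hom X′ X} {g : Hom V X′} {k : Hom V Y} → (f ⊗id) ∘ ⟨ g , k ⟩ ≈ ⟨ f ∘ g , k ⟩
  ⊗id∘⟨⟩ = ≈.trans ⟨⟩∘ (⟨⟩-cong (≈.trans assoc (∘-resp-≈ ≈.refl pr₁-⟨⟩)) pr₂-⟨⟩)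

  IsWeakProduct-uncons : ∀ {m X E} {W : Fin (suc m) → Obj} {p : Hom E X} {q : ∀ j → Hom E (W j)} →
    IsWeakProduct C W p q → IsWeakProduct C (W ∘′ suc) ⟨ p , q zero ⟩ (λ j → q (suc j))
  IsWeakProduct-uncons w = record
    { factor   = λ f g → factor (pr₁ ∘ f) (λ { zero → pr₂ ∘ f ; (suc j) → g j })
    ; p∘factor = ≈.trans ⟨⟩∘ (≈.trans (⟨⟩-cong p∘factor (q∘factor zero)) ⟨⟩-η)
    ; q∘factor = λ j → q∘factor (suc j)
    }
    where open IsWeakProduct w

module DoctrineProperties {o h e} {C : Category o h e} {c ℓ} (P : BooleanDoctrine C c ℓ) where
  private
    module C = Category C
  open C using (Obj; Hom)
  open BooleanDoctrine P public

  module _ {X : Obj} where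
    open BooleanAlgebra (P₀ X) public
      using (_≈_; _∧_; _∨_; ¬_; ⊥; sym; trans; ∧-congʳ)
    open BooleanAlgebraOrder (P₀ X) public
    open ≤-Reasoning poset public

  module _ {X Y : Obj} (f : Hom X Y) where
    open BooleanAlgebraHomomorphism (P₁-hom f) public
      renaming (pres-≤ to P₁-mono; pres-∧¬ to P₁-∧¬; pres-⋁ to P₁-⋁)

  P₁-resp-∘ : ∀ {X Y Z} {f : Hom X Y} {g : Hom Y Z} {k : Hom X Z} → g C.∘ f C.≈ k →
              ∀ a → P₁ f (P₁ g a) ≈ P₁ k a
  P₁-resp-∘ {f = f} {g} g∘f≈k a = trans (sym (P₁-∘ f g a)) (P₁-resp g∘f≈k a)

module FirstOrderProperties {o h e} {D : Category o h e} (FD : FiniteProducts D)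
    {c ℓ} (R : BooleanDoctrine D c ℓ) (R-fo : IsFirstOrder FD R) where
  open Category D using (Obj; Hom; id)
  open CategoryProperties D using (module ≈)
  open FiniteProducts FD
  open DoctrineProperties R public
  open IsFirstOrder R-fo
  open ProductProperties FD

  ∀-intro : ∀ {X Y} {a : Fib X} {b : Fib (X × Y)} → P₁ pr₁ a ≤ b → a ≤ ∀′ X Y b
  ∀-intro {a = a} {b} p = Leq⇒≤ (adj→ a b (≤⇒Leq p))

  ∀-elim : ∀ {X Y} {b : Fib (X × Y)} → P₁ pr₁ (∀′ X Y b) ≤ b
  ∀-elim {b = b} = Leq⇒≤ (adj← (∀′ _ _ b) b (≤⇒Leq ≤-refl))

  ∀-instance : ∀ {V X Y} (f : Hom V X) (t : Hom V Y) (b : Fib (X × Y)) →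
               P₁ f (∀′ X Y b) ≤ P₁ ⟨ f , t ⟩ b
  ∀-instance f t b = begin
    P₁ f (∀′ _ _ b)                  ≈⟨ sym (P₁-resp-∘ pr₁-⟨⟩ (∀′ _ _ b)) ⟩
    P₁ ⟨ f , t ⟩ (P₁ pr₁ (∀′ _ _ b))  ≤⟨ P₁-mono ⟨ f , t ⟩ ∀-elim ⟩
    P₁ ⟨ f , t ⟩ b                   ∎

  ∀∨-intro : ∀ {X Y} (a : Fib X) (b : Fib (X × Y)) (c : Fib X) →
             P₁ pr₁ a ∧ ¬ b ≤ P₁ pr₁ c → a ≤ ∀′ X Y b ∨ c
  ∀∨-intro a b c h = ∧¬≤⇒≤∨ (∧¬≤-contrapose (∀-intro (begin
    P₁ pr₁ (a ∧ ¬ c)         ≈⟨ P₁-∧¬ pr₁ a c ⟩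
    P₁ pr₁ a ∧ ¬ P₁ pr₁ c    ≤⟨ ∧¬≤-contrapose h ⟩
    b                        ∎)))

  P₁-⋁∀ : ∀ {V X} (f : Hom V X) m (W : Fin m → Obj) (b : ∀ j → Fib (X × W j)) →
          P₁ f (⋁ (P₀ X) m (λ j → ∀′ X (W j) (b j))) ≈ ⋁ (P₀ V) m (λ j → ∀′ V (W j) (P₁ (f ⊗id) (b j)))
  P₁-⋁∀ f m W b = trans (P₁-⋁ f m _) (⋁-cong m (λ j → beck-chevalley f (b j)))

  ⋁∀-intro : ∀ m {X E} {W : Fin m → Obj} (a : Fib X) (b : ∀ j → Fib (X × W j))
             {p : Hom E X} {q : ∀ j → Hom E (W j)} → IsWeakProduct D W p q →
             P₁ p a ≤ ⋁ (P₀ E) m (λ j → P₁ ⟨ p , q j ⟩ (b j)) →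
             a ≤ ⋁ (P₀ X) m (λ j → ∀′ X (W j) (b j))
  ⋁∀-intro zero {X} {E} a b {p} w hyp = begin
    a                   ≈⟨ sym (P₁-id a) ⟩
    P₁ id a             ≈⟨ sym (P₁-resp-∘ p∘factor a) ⟩
    P₁ k (P₁ p a)       ≤⟨ P₁-mono k hyp ⟩
    P₁ k ⊥              ≈⟨ IsBAHom.pres-⊥ (P₁-hom k) ⟩
    ⊥                   ∎
    where
    open IsWeakProduct w
    k : Hom X E
    k = factor id (λ ())
  ⋁∀-intro (suc m) {X} {E} {W} a b {p} {q} w hyp =
    ∀∨-intro a (b zero) (⋁ (P₀ X) m (λ j → ∀′ X (W (suc j)) (b (suc j)))) (begin
      P₁ pr₁ a ∧ ¬ b zero
        ≤⟨ ⋁∀-intro m (P₁ pr₁ a ∧ ¬ b zero) b′ (IsWeakProduct-uncons w) hyp′ ⟩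
      ⋁ (P₀ (X × W zero)) m (λ j → ∀′ (X × W zero) (W (suc j)) (b′ j))
        ≈⟨ sym (P₁-⋁∀ pr₁ m (W ∘′ suc) (λ j → b (suc j))) ⟩
      P₁ pr₁ (⋁ (P₀ X) m (λ j → ∀′ X (W (suc j)) (b (suc j))))  ∎)
    where
    p′ : Hom E (X × W zero)
    p′ = ⟨ p , q zero ⟩
    b′ : ∀ j → Fib ((X × W zero) × W (suc j))
    b′ j = P₁ (pr₁ ⊗id) (b (suc j))
    hyp′ : P₁ p′ (P₁ pr₁ a ∧ ¬ b zero) ≤ ⋁ (P₀ E) m (λ j → P₁ ⟨ p′ , q (suc j) ⟩ (b′ j))
    hyp′ = begin
      P₁ p′ (P₁ pr₁ a ∧ ¬ b zero)
        ≈⟨ trans (P₁-∧¬ p′ _ _) (∧-congʳ (P₁-resp-∘ pr₁-⟨⟩ a)) ⟩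
      P₁ p a ∧ ¬ P₁ p′ (b zero)
        ≤⟨ ≤∨⇒∧¬≤ hyp ⟩
      ⋁ (P₀ E) m (λ j → P₁ ⟨ p , q (suc j) ⟩ (b (suc j)))
        ≈⟨ ⋁-cong m (λ j → sym (P₁-resp-∘ (≈.trans ⊗id∘⟨⟩ (⟨⟩-cong pr₁-⟨⟩ ≈.refl)) (b (suc j)))) ⟩
      ⋁ (P₀ E) m (λ j → P₁ ⟨ p′ , q (suc j) ⟩ (b′ j))  ∎

  ⋀∀-instances : ∀ {V X} (f : Hom V X) ī (Y : Fin ī → Obj) (b : ∀ i → Fib (X × Y i))
                 n (l : Fin n → Fin ī) (t : ∀ k → Hom V (Y (l k))) →
                 P₁ f (⋀ (P₀ X) ī (λ i → ∀′ X (Y i) (b i))) ≤ ⋀ (P₀ V) n (λ k → P₁ ⟨ f , t k ⟩ (b (l k)))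
  ⋀∀-instances f ī Y b n l t = ⋀-greatest n _ (λ k →
    ≤-trans (P₁-mono f (⋀-lower ī _ (l k))) (∀-instance f (t k) (b (l k))))

module ProductPreservingFunctor {o h e o′ h′ e′} {C : Category o h e} {D : Category o′ h′ e′}
    {FC : FiniteProducts C} {FD : FiniteProducts D} {M : Functor C D}
    (M-pres : PreservesFiniteProducts FC FD M) where
  private
    module C = Category C
    module FC = FiniteProducts FC
  open Category D
  open FiniteProducts FD
  open CategoryProperties D
  open ProductProperties FD
  open Functor M
  open PreservesFiniteProducts M-pres

  M-pairing : ∀ {V A B} → Hom V (F₀ A) → Hom V (F₀ B) → Hom V (F₀ (A FC.× B))
  M-pairing x y = φ⁻¹ ∘ ⟨ x , y ⟩

  M-pr∘M-pairing : ∀ {V A B} {x : Hom V (F₀ A)} {y : Hom V (F₀ B)} →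
                   ⟨ F₁ FC.pr₁ ∘ M-pairing x y , F₁ FC.pr₂ ∘ M-pairing x y ⟩ ≈ ⟨ x , y ⟩
  M-pr∘M-pairing {x = x} {y} = begin
    ⟨ F₁ FC.pr₁ ∘ M-pairing x y , F₁ FC.pr₂ ∘ M-pairing x y ⟩  ≈⟨ ≈.sym ⟨⟩∘ ⟩
    ⟨ F₁ FC.pr₁ , F₁ FC.pr₂ ⟩ ∘ (φ⁻¹ ∘ ⟨ x , y ⟩)              ≈⟨ ≈.sym assoc ⟩
    (⟨ F₁ FC.pr₁ , F₁ FC.pr₂ ⟩ ∘ φ⁻¹) ∘ ⟨ x , y ⟩              ≈⟨ ∘-resp-≈ φ⁻¹-isoˡ ≈.refl ⟩
    id ∘ ⟨ x , y ⟩                                            ≈⟨ identityˡ ⟩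
    ⟨ x , y ⟩                                                 ∎
    where open HomReasoning

  M-pr₁∘M-pairing : ∀ {V A B} {x : Hom V (F₀ A)} {y : Hom V (F₀ B)} → F₁ FC.pr₁ ∘ M-pairing x y ≈ x
  M-pr₁∘M-pairing = ⟨⟩-injectiveˡ M-pr∘M-pairing

  M-∘pr₂∘M-pairing : ∀ {V A B W} {k : C.Hom B W} {x : Hom V (F₀ A)} {y : Hom V (F₀ B)} →
                     F₁ (k C.∘ FC.pr₂) ∘ M-pairing x y ≈ F₁ k ∘ y
  M-∘pr₂∘M-pairing {k = k} {x} {y} = begin
    F₁ (k C.∘ FC.pr₂) ∘ M-pairing x y     ≈⟨ ∘-resp-≈ (F-∘ FC.pr₂ k) ≈.refl ⟩
    (F₁ k ∘ F₁ FC.pr₂) ∘ M-pairing x y    ≈⟨ assoc ⟩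
    F₁ k ∘ (F₁ FC.pr₂ ∘ M-pairing x y)    ≈⟨ ∘-resp-≈ ≈.refl (⟨⟩-injectiveʳ M-pr∘M-pairing) ⟩
    F₁ k ∘ y                              ∎
    where open HomReasoning

  M-⟨⟩ : ∀ {V A B} {f : C.Hom V A} {g : C.Hom V B} → F₁ FC.⟨ f , g ⟩ ≈ M-pairing (F₁ f) (F₁ g)
  M-⟨⟩ {f = f} {g} = begin
    F₁ FC.⟨ f , g ⟩                                                  ≈⟨ ≈.sym identityˡ ⟩
    id ∘ F₁ FC.⟨ f , g ⟩                                             ≈⟨ ∘-resp-≈ (≈.sym φ⁻¹-isoʳ) ≈.refl ⟩
    (φ⁻¹ ∘ ⟨ F₁ FC.pr₁ , F₁ FC.pr₂ ⟩) ∘ F₁ FC.⟨ f , g ⟩              ≈⟨ assoc ⟩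
    φ⁻¹ ∘ (⟨ F₁ FC.pr₁ , F₁ FC.pr₂ ⟩ ∘ F₁ FC.⟨ f , g ⟩)              ≈⟨ ∘-resp-≈ ≈.refl ⟨⟩∘ ⟩
    φ⁻¹ ∘ ⟨ F₁ FC.pr₁ ∘ F₁ FC.⟨ f , g ⟩ , F₁ FC.pr₂ ∘ F₁ FC.⟨ f , g ⟩ ⟩
      ≈⟨ ∘-resp-≈ ≈.refl (⟨⟩-cong (M-resp-∘ FC.pr₁-⟨⟩) (M-resp-∘ FC.pr₂-⟨⟩)) ⟩
    φ⁻¹ ∘ ⟨ F₁ f , F₁ g ⟩                                            ∎
    where
    open HomReasoning
    M-resp-∘ : ∀ {X Y Z} {a : C.Hom X Y} {b : C.Hom Y Z} {c : C.Hom X Z} → b C.∘ a C.≈ c → F₁ b ∘ F₁ a ≈ F₁ c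
    M-resp-∘ {a = a} {b} eq = ≈.trans (≈.sym (F-∘ a b)) (F-resp eq)

  M-tuple : ∀ {V} m (Z : Fin m → C.Obj) → (∀ j → Hom V (F₀ (Z j))) → Hom V (F₀ (FC.∏ m Z))
  M-tuple zero    Z h = u ∘ !
  M-tuple (suc m) Z h = M-pairing (h zero) (M-tuple m (Z ∘′ suc) (λ j → h (suc j)))

  M-π∘M-tuple : ∀ {V} m (Z : Fin m → C.Obj) (h : ∀ j → Hom V (F₀ (Z j))) j →
                F₁ (FC.π m Z j) ∘ M-tuple m Z h ≈ h j
  M-π∘M-tuple (suc m) Z h zero    = M-pr₁∘M-pairing
  M-π∘M-tuple (suc m) Z h (suc j) =
    ≈.trans M-∘pr₂∘M-pairing (M-π∘M-tuple m (Z ∘′ suc) (λ i → h (suc i)) j)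

  M-weakProduct : ∀ {S} m (Z : Fin m → C.Obj) →
    IsWeakProduct D (λ j → F₀ (Z j)) (F₁ (FC.pr₁ {S})) (λ j → F₁ (FC.π m Z j C.∘ FC.pr₂))
  M-weakProduct m Z = record
    { factor   = λ f h → M-pairing f (M-tuple m Z h)
    ; p∘factor = M-pr₁∘M-pairing
    ; q∘factor = λ j → ≈.trans M-∘pr₂∘M-pairing (M-π∘M-tuple m Z _ j)
    }

module DoctrineMorphismProperties {o h e o′ h′ e′ c ℓ c′ ℓ′}
    {C : Category o h e} {D : Category o′ h′ e′}
    {FC : FiniteProducts C} {FD : FiniteProducts D}
    {P : BooleanDoctrine C c ℓ} {R : BooleanDoctrine D c′ ℓ′}
    (Mm : DoctrineMorphism FC FD P R) where
  private
    module C = Category C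
    module FC = FiniteProducts FC
    module P = BooleanDoctrine P
  open FiniteProducts FD using (⟨_,_⟩)
  open DoctrineProperties R
  open DoctrineMorphism Mm
  open Functor M
  open PreservesFiniteProducts M-pres
  open ProductPreservingFunctor M-pres

  𝔪-P₁-⟨⟩ : ∀ {V A B} (f : C.Hom V A) (k : C.Hom V B) (γ : P.Fib (A FC.× B)) →
            𝔪 V (P.P₁ FC.⟨ f , k ⟩ γ) ≈ P₁ ⟨ F₁ f , F₁ k ⟩ (P₁ φ⁻¹ (𝔪 (A FC.× B) γ))
  𝔪-P₁-⟨⟩ f k γ =
    trans (𝔪-natural FC.⟨ f , k ⟩ γ) (trans (P₁-resp M-⟨⟩ _) (P₁-∘ ⟨ F₁ f , F₁ k ⟩ φ⁻¹ _))

lemma4p6 : ∀ {o h e o′ h′ e′ c ℓ c′ ℓ′ : Level}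
    {C : Category o h e} {D : Category o′ h′ e′}
    (FC : FiniteProducts C) (FD : FiniteProducts D)
    (P : BooleanDoctrine C c ℓ) (R : BooleanDoctrine D c′ ℓ′)
    (Rfo : IsFirstOrder FD R)
    (Mm : DoctrineMorphism FC FD P R)
    (ī j̄ : ℕ) (S : Category.Obj C)
    (Y : Fin ī → Category.Obj C) (Z : Fin j̄ → Category.Obj C)
    (α : (i : Fin ī) → BooleanDoctrine.Fib P (FiniteProducts._×_ FC S (Y i)))
    (β : (j : Fin j̄) → BooleanDoctrine.Fib P (FiniteProducts._×_ FC S (Z j)))
    (n : ℕ) (l : Fin n → Fin ī)
    (g : (k : Fin n) → Category.Hom C (FiniteProducts._×_ FC S (FiniteProducts.∏ FC j̄ Z)) (Y (l k))) →
    Leq (BooleanDoctrine.P₀ P (FiniteProducts._×_ FC S (FiniteProducts.∏ FC j̄ Z)))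
      (⋀ (BooleanDoctrine.P₀ P (FiniteProducts._×_ FC S (FiniteProducts.∏ FC j̄ Z))) n
        (λ k → BooleanDoctrine.P₁ P (FiniteProducts.⟨_,_⟩ FC (FiniteProducts.pr₁ FC) (g k)) (α (l k))))
      (⋁ (BooleanDoctrine.P₀ P (FiniteProducts._×_ FC S (FiniteProducts.∏ FC j̄ Z))) j̄
        (λ j → BooleanDoctrine.P₁ P
          (FiniteProducts.⟨_,_⟩ FC (FiniteProducts.pr₁ FC)
            (Category._∘_ C (FiniteProducts.π FC j̄ Z j) (FiniteProducts.pr₂ FC)))
          (β j))) →
    Leq (BooleanDoctrine.P₀ R (Functor.F₀ (DoctrineMorphism.M Mm) S))
      (⋀ (BooleanDoctrine.P₀ R (Functor.F₀ (DoctrineMorphism.M Mm) S)) ī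
        (λ i → IsFirstOrder.∀′ Rfo (Functor.F₀ (DoctrineMorphism.M Mm) S) (Functor.F₀ (DoctrineMorphism.M Mm) (Y i))
          (BooleanDoctrine.P₁ R (PreservesFiniteProducts.φ⁻¹ (DoctrineMorphism.M-pres Mm))
            (DoctrineMorphism.𝔪 Mm (FiniteProducts._×_ FC S (Y i)) (α i)))))
      (⋁ (BooleanDoctrine.P₀ R (Functor.F₀ (DoctrineMorphism.M Mm) S)) j̄
        (λ j → IsFirstOrder.∀′ Rfo (Functor.F₀ (DoctrineMorphism.M Mm) S) (Functor.F₀ (DoctrineMorphism.M Mm) (Z j))
          (BooleanDoctrine.P₁ R (PreservesFiniteProducts.φ⁻¹ (DoctrineMorphism.M-pres Mm))
            (DoctrineMorphism.𝔪 Mm (FiniteProducts._×_ FC S (Z j)) (β j)))))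
lemma4p6 {C = C} FC FD P R R-fo Mm ī j̄ S Y Z α β n l g hyp =
  ≤⇒Leq (⋁∀-intro j̄ (⋀ (P₀ (F₀ S)) ī ∀α̃) β̃ (M-weakProduct j̄ Z) (begin
    P₁ (F₁ FC.pr₁) (⋀ (P₀ (F₀ S)) ī ∀α̃)
      ≤⟨ ⋀∀-instances (F₁ FC.pr₁) ī (λ i → F₀ (Y i)) α̃ n l (λ k → F₁ (g k)) ⟩
    ⋀ (P₀ (F₀ T)) n (λ k → P₁ ⟨ F₁ FC.pr₁ , F₁ (g k) ⟩ (α̃ (l k)))
      ≈⟨ sym (trans (𝔪T.pres-⋀ n _) (⋀-cong n (λ k → 𝔪-P₁-⟨⟩ FC.pr₁ (g k) (α (l k))))) ⟩
    𝔪 T (⋀ (P.P₀ T) n (λ k → P.P₁ FC.⟨ FC.pr₁ , g k ⟩ (α (l k))))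
      ≤⟨ 𝔪T.pres-≤ (P≤.Leq⇒≤ hyp) ⟩
    𝔪 T (⋁ (P.P₀ T) j̄ (λ j → P.P₁ FC.⟨ FC.pr₁ , q j ⟩ (β j)))
      ≈⟨ trans (𝔪T.pres-⋁ j̄ _) (⋁-cong j̄ (λ j → 𝔪-P₁-⟨⟩ FC.pr₁ (q j) (β j))) ⟩
    ⋁ (P₀ (F₀ T)) j̄ (λ j → P₁ ⟨ F₁ FC.pr₁ , F₁ (q j) ⟩ (β̃ j))  ∎))
  where
  module C = Category C
  module FC = FiniteProducts FC
  module P = BooleanDoctrine P
  module P≤ {X} = BooleanAlgebraOrder (P.P₀ X)
  module FD = FiniteProducts FD
  open FirstOrderProperties FD R R-fo
  open IsFirstOrder R-fo using (∀′)
  open FD using (⟨_,_⟩)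
  open DoctrineMorphism Mm using (M; M-pres; 𝔪; 𝔪-hom)
  open Functor M using (F₀; F₁)
  open PreservesFiniteProducts M-pres using (φ⁻¹)
  open ProductPreservingFunctor M-pres using (M-weakProduct)
  open DoctrineMorphismProperties Mm using (𝔪-P₁-⟨⟩)

  T : C.Obj
  T = S FC.× FC.∏ j̄ Z
  module 𝔪T = BooleanAlgebraHomomorphism (𝔪-hom T)

  q : ∀ j → C.Hom T (Z j)
  q j = FC.π j̄ Z j C.∘ FC.pr₂

  α̃ : ∀ i → Fib (F₀ S FD.× F₀ (Y i))
  α̃ i = P₁ φ⁻¹ (𝔪 (S FC.× Y i) (α i))

  β̃ : ∀ j → Fib (F₀ S FD.× F₀ (Z j))
  β̃ j = P₁ φ⁻¹ (𝔪 (S FC.× Z j) (β j))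

  ∀α̃ : ∀ i → Fib (F₀ S)
  ∀α̃ i = ∀′ (F₀ S) (F₀ (Y i)) (α̃ i)
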